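{- Let $A$, $B$, $C$ be $m \times n$ matrices over $\{ -1,0,1\}$ such that $A$ has an entry $0$ and ${\rm IST}(A,B,C)=\infty$. If $B$ and $C$ are not layered matrices, then all entries of $A$ are $0$.
   Context: For an $m\times n$ matrix $M=[m_{ij}]$ over $\{ -1,0,1\}$, $G_o(M)$ is the directed graph on $\{1,\dots,n+m\}$ with edges $j\to i$ for all $1\le j<i\le n$, and for $1\le p\le m$, $1\le j\le n$: an edge $j\to n+p$ if $m_{pj}=1$, an edge $n+p\to j$ if $m_{pj}=-1$, no edge if $m_{pj}=0$; no edges among $n+1,\dots,n+m$. A directed graph is semi-transitive if it is acyclic and for every directed path $u_1\to\cdots\to u_t$, $t\ge2$, either there is no edge $u_1\to u_t$ or all edges $u_i\to u_j$ ($1\le i<j\le t$) exist. For $m\times n$ matrices $A,B,C$ over $\{ -1,0,1\}$, the morphism $\varphi$ replaces each entry $0,1,-1$ by the block $A,B,C$ respectively; $M^k(A,B,C)=\varphi^k([0])$ and $G_o^k(A,B,C)=G_o(M^k(A,B,C))$. If $A$ has an entry $0$, ${\rm IST}(A,B,C)$ is the least $\ell\ge0$ with $G_o^\ell(A,B,C)$ not semi-transitive, or $\infty$ if none exists. A matrix is layered if all entries in each row are identical. -}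

module Defs where

open import Data.Nat using (ℕ; zero; suc; _*_; _^_)
open import Data.Fin using (Fin; zero; suc; fromℕ; quotient; remainder; _<_)
open import Data.Sum using (_⊎_; inj₁; inj₂)
open import Data.Product using (Σ; ∃; _×_; _,_)
open import Data.Empty using (⊥)
open import Relation.Nullary using (¬_)
open import Relation.Binary.PropositionalEquality using (_≡_)

data Entry : Set where
  zer one neg : Entry      -- 0, 1, -1

Matrix : ℕ → ℕ → Set
Matrix m n = Fin m → Fin n → Entry

module _ {m n : ℕ} (A B C : Matrix m n) where

  -- the block substituted for an entry by the morphism φ
  block : Entry → Matrix m n
  block zer = A
  block one = B
  block neg = C

  -- φ^k([x]) : an (m^k × n^k) matrix.
  -- φ^(k+1)([x]) = φ^k(block x), i.e. its (p,q) block (p,q indexed by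
  -- the most significant digit) is φ^k([ (block x) p q ]).
  φpow : (k : ℕ) → Entry → Matrix (m ^ k) (n ^ k)
  φpow zero    x _ _ = x
  φpow (suc k) x i j =
    φpow k (block x (quotient (m ^ k) i) (quotient (n ^ k) j))
      (remainder {m} (m ^ k) i) (remainder {n} (n ^ k) j)

  Mpow : (k : ℕ) → Matrix (m ^ k) (n ^ k)
  Mpow k = φpow k zer

-- Vertices of G_o(M) for M : Matrix m n :
-- inj₁ j  is column vertex j (vertex j+1 in {1..n}),
-- inj₂ p  is row vertex p    (vertex n+p+1).
Vertex : ℕ → ℕ → Set
Vertex m n = Fin n ⊎ Fin m

Edge : {m n : ℕ} → Matrix m n → Vertex m n → Vertex m n → Set
Edge M (inj₁ j) (inj₁ i) = j < i
Edge M (inj₁ j) (inj₂ p) = M p j ≡ one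
Edge M (inj₂ p) (inj₁ j) = M p j ≡ neg
Edge M (inj₂ p) (inj₂ q) = ⊥

IsWalk : {V : Set} (E : V → V → Set) (t : ℕ) → (Fin (suc t) → V) → Set
IsWalk E t u = (i : Fin t) → E (u (Data.Fin.inject₁ i)) (u (suc i))

Acyclic : {V : Set} → (V → V → Set) → Set
Acyclic E = ¬ (Σ ℕ λ t → Σ (Fin (suc (suc t)) → _) λ u →
                 IsWalk E (suc t) u × (u zero ≡ u (fromℕ (suc t))))

SemiTransitive : {V : Set} → (V → V → Set) → Set
SemiTransitive {V} E =
  Acyclic E ×
  ((t : ℕ) (u : Fin (suc (suc t)) → V) → IsWalk E (suc t) u →
     E (u zero) (u (fromℕ (suc t))) →
     (i j : Fin (suc (suc t))) → i < j → E (u i) (u j))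

GoPowSemiTransitive : {m n : ℕ} → Matrix m n → Matrix m n → Matrix m n → ℕ → Set
GoPowSemiTransitive A B C k = SemiTransitive (Edge (Mpow A B C k))

ISTinfinite : {m n : ℕ} → Matrix m n → Matrix m n → Matrix m n → Set
ISTinfinite A B C = (ℓ : ℕ) → GoPowSemiTransitive A B C ℓ

Layered : {m n : ℕ} → Matrix m n → Set
Layered M = ∀ p j j′ → M p j ≡ M p j′

HasZeroEntry : {m n : ℕ} → Matrix m n → Set
HasZeroEntry A = ∃ λ p → ∃ λ j → A p j ≡ zer

-- In a row of a matrix M with G_o(M) semi-transitive, a nonzero value has no other value
-- between two of its occurrences, no -1 precedes a 1, and a 0 cannot flank a pair of
-- distinct nonzero values; in particular a non-constant pattern never occurs twice, one
-- copy to the left of the other. Row (p, x) of M² = φ(A) strings together the rows x of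
-- the blocks substituted for row p of A, so a value repeated in a row of A has a layered
-- block and hence is 0, as B and C are not layered. If A p j₀ = 0 ≠ A p j = v, the
-- entries of M² and M³ in rows (p, p) and (p, p, p) at columns spelled with j₀ and j force
-- the block of v to be layered; so row p of A vanishes, A is layered, and every entry of A
-- repeats in its row and is 0.
module Submission where

open import Defs
open import Data.Nat using (ℕ; zero; suc; _*_; _^_; z≤n; s≤s)
import Data.Nat as ℕ
open import Data.Nat.Properties using (+-monoʳ-<)
open import Data.Fin using (Fin; zero; suc; _<_; combine; toℕ)
open import Data.Fin.Properties using (<-trans; <-cmp; _≟_; combine-monoˡ-<; toℕ-combine; remQuot-combine)
open import Data.Sum using (inj₁; inj₂)
open import Data.Empty using (⊥)
open import Data.Product using (∃; _×_; _,_; proj₁; proj₂)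
open import Function using (_∘_)
open import Relation.Nullary using (¬_; Dec; yes; no; contradiction)
open import Relation.Binary using (Tri; tri<; tri≈; tri>; _Preserves_⟶_)
open import Relation.Binary.PropositionalEquality
  using (_≡_; _≢_; _≗_; refl; sym; trans; cong; cong₂; subst; subst₂; ≢-sym)

≡zer? : (x : Entry) → Dec (x ≡ zer)
≡zer? zer = yes refl
≡zer? one = no λ ()
≡zer? neg = no λ ()

another-column : ∀ {m n} {M : Matrix m n} → ¬ Layered M → (j : Fin n) → ∃ (_≢ j)
another-column {n = suc zero}    ¬L zero    = contradiction (λ { _ zero zero → refl }) ¬L
another-column {n = suc (suc n)} ¬L zero    = suc zero , λ ()
another-column {n = suc (suc n)} ¬L (suc j) = zero , λ ()

path₄ : ∀ {V : Set} → V → V → V → V → Fin 4 → V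
path₄ a b c d zero                   = a
path₄ a b c d (suc zero)             = b
path₄ a b c d (suc (suc zero))       = c
path₄ a b c d (suc (suc (suc zero))) = d

module _ {V : Set} {E : V → V → Set} where

  walk₄ : ∀ {a b c d} → E a b → E b c → E c d → IsWalk E 3 (path₄ a b c d)
  walk₄ ab bc cd zero             = ab
  walk₄ ab bc cd (suc zero)       = bc
  walk₄ ab bc cd (suc (suc zero)) = cd

  Acyclic⇒¬triangle : Acyclic E → ∀ {a b c} → E a b → E b c → ¬ E c a
  Acyclic⇒¬triangle acyclic {a} {b} {c} ab bc ca =
    acyclic (2 , path₄ a b c a , walk₄ ab bc ca , refl)

  SemiTransitive⇒chords : SemiTransitive E → ∀ {a b c d} →
    E a b → E b c → E c d → E a d → E a c × E b d
  SemiTransitive⇒chords (_ , shortcut) {a} {b} {c} {d} ab bc cd ad =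
    chord zero (suc (suc zero)) (s≤s z≤n) ,
    chord (suc zero) (suc (suc (suc zero))) (s≤s (s≤s z≤n))
    where chord = shortcut 2 (path₄ a b c d) (walk₄ ab bc cd) ad

module SemiTransitiveRow {R K : ℕ} {N : Matrix R K} (st : SemiTransitive (Edge N)) (r : Fin R)
  where

  neg-before-one : ∀ {a c} → a < c → N r a ≡ neg → N r c ≢ one
  neg-before-one {a} {c} a<c ra =
    Acyclic⇒¬triangle {E = Edge N} (proj₁ st) {inj₂ r} {inj₁ a} {inj₁ c} ra a<c

  one-convex : ∀ {a b c} → a < b → b < c → N r a ≡ one → N r c ≡ one → N r b ≡ one
  one-convex {a} {b} {c} a<b b<c ra rc =
    proj₂ (SemiTransitive⇒chords {E = Edge N} st {inj₁ a} {inj₁ b} {inj₁ c} {inj₂ r} a<b b<c rc ra)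

  neg-convex : ∀ {a b c} → a < b → b < c → N r a ≡ neg → N r c ≡ neg → N r b ≡ neg
  neg-convex {a} {b} {c} a<b b<c ra rc =
    proj₁ (SemiTransitive⇒chords {E = Edge N} st {inj₂ r} {inj₁ a} {inj₁ b} {inj₁ c} ra a<b b<c rc)

  nonzero-convex : ∀ {a b c v} → v ≢ zer → a < b → b < c → N r a ≡ v → N r c ≡ v → N r b ≡ v
  nonzero-convex {v = zer} v≢0 = contradiction refl v≢0
  nonzero-convex {v = one} _   = one-convex
  nonzero-convex {v = neg} _   = neg-convex

  neg-after-one-neg : ∀ {a b c} → a < b → b < c → N r a ≡ one → N r b ≡ neg → N r c ≡ neg
  neg-after-one-neg {a} {b} {c} a<b b<c ra rb =
    proj₂ (SemiTransitive⇒chords {E = Edge N} st {inj₁ a} {inj₂ r} {inj₁ b} {inj₁ c}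
             ra rb b<c (<-trans a<b b<c))

  one-before-one-neg : ∀ {a b c} → a < b → b < c → N r b ≡ one → N r c ≡ neg → N r a ≡ one
  one-before-one-neg {a} {b} {c} a<b b<c rb rc =
    proj₁ (SemiTransitive⇒chords {E = Edge N} st {inj₁ a} {inj₁ b} {inj₂ r} {inj₁ c}
             a<b rb rc (<-trans a<b b<c))

  zero-then-nonzeros : ∀ {a b c x y} → a < b → b < c → x ≢ zer → y ≢ zer →
    N r a ≡ zer → N r b ≡ x → N r c ≡ y → x ≡ y
  zero-then-nonzeros {x = zer} _ _ x≢0 _ = contradiction refl x≢0
  zero-then-nonzeros {y = zer} _ _ _ y≢0 = contradiction refl y≢0
  zero-then-nonzeros {x = one} {one} _ _ _ _ _ _ _ = refl
  zero-then-nonzeros {x = neg} {neg} _ _ _ _ _ _ _ = refl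
  zero-then-nonzeros {x = one} {neg} a<b b<c _ _ ra rb rc =
    contradiction (trans (sym ra) (one-before-one-neg a<b b<c rb rc)) λ ()
  zero-then-nonzeros {x = neg} {one} _ b<c _ _ _ rb rc = contradiction rc (neg-before-one b<c rb)

  nonzeros-then-zero : ∀ {a b c x y} → a < b → b < c → x ≢ zer → y ≢ zer →
    N r a ≡ x → N r b ≡ y → N r c ≡ zer → x ≡ y
  nonzeros-then-zero {x = zer} _ _ x≢0 _ = contradiction refl x≢0
  nonzeros-then-zero {y = zer} _ _ _ y≢0 = contradiction refl y≢0
  nonzeros-then-zero {x = one} {one} _ _ _ _ _ _ _ = refl
  nonzeros-then-zero {x = neg} {neg} _ _ _ _ _ _ _ = refl
  nonzeros-then-zero {x = one} {neg} a<b b<c _ _ ra rb rc =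
    contradiction (trans (sym rc) (neg-after-one-neg a<b b<c ra rb)) λ ()
  nonzeros-then-zero {x = neg} {one} a<b _ _ _ ra rb _ = contradiction rb (neg-before-one a<b ra)

  repeated-pattern-constant : ∀ {k} {e e′ : Fin k → Fin K} →
    e Preserves _<_ ⟶ _<_ → e′ Preserves _<_ ⟶ _<_ → (∀ s t → e s < e′ t) →
    (f : Fin k → Entry) → N r ∘ e ≗ f → N r ∘ e′ ≗ f → ∀ s t → f s ≡ f t
  repeated-pattern-constant {e = e} {e′} e-mono e′-mono e<e′ f re re′ s t =
    by-zeros (≡zer? (f s)) (≡zer? (f t))
    where
    agrees : ∀ s t → f s ≢ zer → f t ≡ f s
    agrees s t fs≢0 with <-cmp s t
    ... | tri< s<t _ _  = trans (sym (re t))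
                                 (nonzero-convex fs≢0 (e-mono s<t) (e<e′ t s) (re s) (re′ s))
    ... | tri≈ _ refl _ = refl
    ... | tri> _ _ t<s  = trans (sym (re′ t))
                                 (nonzero-convex fs≢0 (e<e′ s t) (e′-mono t<s) (re s) (re′ s))

    by-zeros : Dec (f s ≡ zer) → Dec (f t ≡ zer) → f s ≡ f t
    by-zeros (no fs≢0)  _          = sym (agrees s t fs≢0)
    by-zeros (yes _)    (no ft≢0)  = agrees t s ft≢0
    by-zeros (yes fs≡0) (yes ft≡0) = trans fs≡0 (sym ft≡0)

combine-monoʳ-< : ∀ {a b} (i : Fin a) {j k : Fin b} → j < k → combine i j < combine i k
combine-monoʳ-< {b = b} i {j} {k} j<k =
  subst₂ ℕ._<_ (sym (toℕ-combine i j)) (sym (toℕ-combine i k)) (+-monoʳ-< (b * toℕ i) j<k)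

repeated-block-pattern-constant : ∀ {R a b k} {N : Matrix R (a * b)} →
  SemiTransitive (Edge N) → ∀ r {q q′ : Fin a} → q ≢ q′ →
  {g g′ : Fin k → Fin b} → g Preserves _<_ ⟶ _<_ → g′ Preserves _<_ ⟶ _<_ →
  (f : Fin k → Entry) → N r ∘ combine q ∘ g ≗ f → N r ∘ combine q′ ∘ g′ ≗ f →
  ∀ s t → f s ≡ f t
repeated-block-pattern-constant st r {q} {q′} q≢q′ {g} {g′} g-mono g′-mono f rg rg′
  with <-cmp q q′
... | tri< q<q′ _ _ =
  repeated-pattern-constant
    (λ lt → combine-monoʳ-< q (g-mono lt)) (λ lt → combine-monoʳ-< q′ (g′-mono lt))
    (λ s t → combine-monoˡ-< (g s) (g′ t) q<q′) f rg rg′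
  where open SemiTransitiveRow st r
... | tri≈ _ q≡q′ _ = contradiction q≡q′ q≢q′
... | tri> _ _ q′<q =
  repeated-pattern-constant
    (λ lt → combine-monoʳ-< q′ (g′-mono lt)) (λ lt → combine-monoʳ-< q (g-mono lt))
    (λ s t → combine-monoˡ-< (g′ s) (g t) q′<q) f rg′ rg
  where open SemiTransitiveRow st r

[_]₁ : ∀ {a} → Fin a → Fin (a ^ 1)
[ p ]₁ = combine p zero

[_,_]₂ : ∀ {a} → Fin a → Fin a → Fin (a ^ 2)
[ p , q ]₂ = combine p [ q ]₁

[_,_,_]₃ : ∀ {a} → Fin a → Fin a → Fin a → Fin (a ^ 3)
[ p , q , r ]₃ = combine p [ q , r ]₂

[]₁-mono : ∀ {a} → [_]₁ {a} Preserves _<_ ⟶ _<_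
[]₁-mono = combine-monoˡ-< zero zero

[,]₂-monoˡ : ∀ {a} {p p′ : Fin a} q q′ → p < p′ → [ p , q ]₂ < [ p′ , q′ ]₂
[,]₂-monoˡ q q′ = combine-monoˡ-< [ q ]₁ [ q′ ]₁

[,]₂-monoʳ : ∀ {a} (p : Fin a) → [ p ,_]₂ Preserves _<_ ⟶ _<_
[,]₂-monoʳ p q<q′ = combine-monoʳ-< p ([]₁-mono q<q′)

[,,]₃-monoˡ : ∀ {a} {p p′ : Fin a} q r q′ r′ → p < p′ → [ p , q , r ]₃ < [ p′ , q′ , r′ ]₃
[,,]₃-monoˡ q r q′ r′ = combine-monoˡ-< [ q , r ]₂ [ q′ , r′ ]₂

[,,]₃-monoʳ : ∀ {a} (p : Fin a) {q r q′ r′} →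
  [ q , r ]₂ < [ q′ , r′ ]₂ → [ p , q , r ]₃ < [ p , q′ , r′ ]₃
[,,]₃-monoʳ p = combine-monoʳ-< p

module _ {m n : ℕ} (A B C : Matrix m n) where

  φpow-suc-combine : ∀ k x p (P : Fin (m ^ k)) q (Q : Fin (n ^ k)) →
    φpow A B C (suc k) x (combine p P) (combine q Q) ≡ φpow A B C k (block A B C x p q) P Q
  φpow-suc-combine k x p P q Q =
    cong₂ (λ (pP : Fin m × Fin (m ^ k)) (qQ : Fin n × Fin (n ^ k)) →
             φpow A B C k (block A B C x (proj₁ pP) (proj₁ qQ)) (proj₂ pP) (proj₂ qQ))
          (remQuot-combine p P) (remQuot-combine q Q)

  φpow₂-entry : ∀ x p p′ q q′ → φpow A B C 2 x [ p , p′ ]₂ [ q , q′ ]₂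
                 ≡ block A B C (block A B C x p q) p′ q′
  φpow₂-entry x p p′ q q′ =
    trans (φpow-suc-combine 1 x p [ p′ ]₁ q [ q′ ]₁)
          (φpow-suc-combine 0 (block A B C x p q) p′ zero q′ zero)

  Mpow₂-entry : ∀ p p′ q q′ → Mpow A B C 2 [ p , p′ ]₂ [ q , q′ ]₂ ≡ block A B C (A p q) p′ q′
  Mpow₂-entry = φpow₂-entry zer

  Mpow₃-entry : ∀ p p′ p″ q q′ q″ → Mpow A B C 3 [ p , p′ , p″ ]₃ [ q , q′ , q″ ]₃
                  ≡ block A B C (block A B C (A p q) p′ q′) p″ q″
  Mpow₃-entry p p′ p″ q q′ q″ =
    trans (φpow-suc-combine 2 zer p [ p′ , p″ ]₂ q [ q′ , q″ ]₂)
          (φpow₂-entry (A p q) p′ p″ q′ q″)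

module _ {m n : ℕ} {A B C : Matrix m n} where

  private
    X : Entry → Matrix m n
    X = block A B C

  zero-block : ∀ {u} → u ≡ zer → ∀ p q → X u p q ≡ A p q
  zero-block refl p q = refl

  layered-block⇒zer : ¬ Layered B → ¬ Layered C → ∀ u → Layered (X u) → u ≡ zer
  layered-block⇒zer _   _   zer _ = refl
  layered-block⇒zer ¬LB _   one L = contradiction L ¬LB
  layered-block⇒zer _   ¬LC neg L = contradiction L ¬LC

  module _ (st₂ : GoPowSemiTransitive A B C 2) where

    repeated-entry⇒layered : ∀ {p q q′} → q ≢ q′ → A p q ≡ A p q′ → Layered (X (A p q))
    repeated-entry⇒layered {p} {q} {q′} q≢q′ Apq≡Apq′ x =
      repeated-block-pattern-constant st₂ [ p , x ]₂ q≢q′ []₁-mono []₁-mono (X (A p q) x)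
        (Mpow₂-entry A B C p x q)
        (λ Q → trans (Mpow₂-entry A B C p x q′ Q) (cong (λ u → X u x Q) (sym Apq≡Apq′)))

    block-entry-agrees : ∀ {p j₀ j} → A p j₀ ≡ zer → j ≢ j₀ → A p j ≢ zer →
      X (A p j) p j₀ ≢ zer → X (A p j) p j₀ ≡ A p j
    block-entry-agrees {p} {j₀} {j} z j≢j₀ v≢0 w≢0 = by-order (<-cmp j₀ j)
      where
      open SemiTransitiveRow st₂ [ p , p ]₂
      at-j₀j₀ : Mpow A B C 2 [ p , p ]₂ [ j₀ , j₀ ]₂ ≡ zer
      at-j₀j₀ = trans (Mpow₂-entry A B C p p j₀ j₀) (trans (zero-block z p j₀) z)
      at-j₀j : Mpow A B C 2 [ p , p ]₂ [ j₀ , j ]₂ ≡ A p j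
      at-j₀j = trans (Mpow₂-entry A B C p p j₀ j) (zero-block z p j)
      at-jj₀ : Mpow A B C 2 [ p , p ]₂ [ j , j₀ ]₂ ≡ X (A p j) p j₀
      at-jj₀ = Mpow₂-entry A B C p p j j₀
      by-order : Tri (j₀ < j) (j₀ ≡ j) (j < j₀) → X (A p j) p j₀ ≡ A p j
      by-order (tri< j₀<j _ _) = sym (zero-then-nonzeros ([,]₂-monoʳ j₀ j₀<j) ([,]₂-monoˡ j j₀ j₀<j)
                                        v≢0 w≢0 at-j₀j₀ at-j₀j at-jj₀)
      by-order (tri≈ _ j₀≡j _) = contradiction (sym j₀≡j) j≢j₀
      by-order (tri> _ _ j<j₀) = nonzeros-then-zero ([,]₂-monoˡ j₀ j j<j₀) ([,]₂-monoʳ j₀ j<j₀)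
                                   w≢0 v≢0 at-jj₀ at-j₀j at-j₀j₀

  module _ (st₃ : GoPowSemiTransitive A B C 3) where

    swapped-block-layered : ∀ {p j₀ j} → A p j₀ ≡ zer → j ≢ j₀ → X (A p j) p j₀ ≡ A p j →
      Layered (X (A p j))
    swapped-block-layered {p} {j₀} {j} z j≢j₀ w≡v x =
      repeated-block-pattern-constant st₃ [ p , p , x ]₃ (≢-sym j≢j₀) ([,]₂-monoʳ j) ([,]₂-monoʳ j₀)
        (X (A p j) x)
        (λ Q → trans (Mpow₃-entry A B C p p x j₀ j Q) (cong (λ u → X u x Q) (zero-block z p j)))
        (λ Q → trans (Mpow₃-entry A B C p p x j j₀ Q) (cong (λ u → X u x Q) w≡v))

    block-entry-nonzero : ∀ {p j₀ j} → A p j₀ ≡ zer → j ≢ j₀ → A p j ≢ zer →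
      X (A p j) p j₀ ≢ zer
    block-entry-nonzero {p} {j₀} {j} z j≢j₀ v≢0 w≡0 = by-order (<-cmp j₀ j)
      where
      open SemiTransitiveRow st₃ [ p , p , p ]₃
      row : Fin (n ^ 3) → Entry
      row = Mpow A B C 3 [ p , p , p ]₃
      at-j₀j₀j : row [ j₀ , j₀ , j ]₃ ≡ A p j
      at-j₀j₀j = trans (Mpow₃-entry A B C p p p j₀ j₀ j)
                       (trans (cong (λ u → X u p j) (zero-block z p j₀)) (zero-block z p j))
      at-j₀jj₀ : row [ j₀ , j , j₀ ]₃ ≡ zer
      at-j₀jj₀ = trans (Mpow₃-entry A B C p p p j₀ j j₀)
                       (trans (cong (λ u → X u p j₀) (zero-block z p j)) w≡0)
      at-jj₀j : row [ j , j₀ , j ]₃ ≡ A p j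
      at-jj₀j = trans (Mpow₃-entry A B C p p p j j₀ j) (zero-block w≡0 p j)
      at-jj₀j₀ : row [ j , j₀ , j₀ ]₃ ≡ zer
      at-jj₀j₀ = trans (Mpow₃-entry A B C p p p j j₀ j₀) (trans (zero-block w≡0 p j₀) z)
      by-order : Tri (j₀ < j) (j₀ ≡ j) (j < j₀) → ⊥
      by-order (tri< j₀<j _ _) =
        v≢0 (trans (sym (nonzero-convex v≢0 ([,,]₃-monoʳ j₀ ([,]₂-monoˡ j j₀ j₀<j))
                                            ([,,]₃-monoˡ j j₀ j₀ j j₀<j) at-j₀j₀j at-jj₀j))
                   at-j₀jj₀)
      by-order (tri≈ _ j₀≡j _) = j≢j₀ (sym j₀≡j)
      by-order (tri> _ _ j<j₀) =
        v≢0 (trans (sym (nonzero-convex v≢0 ([,,]₃-monoʳ j ([,]₂-monoʳ j₀ j<j₀))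
                                            ([,,]₃-monoˡ j₀ j₀ j₀ j j<j₀) at-jj₀j at-j₀j₀j))
                   at-jj₀j₀)

  module _ (¬LB : ¬ Layered B) (¬LC : ¬ Layered C)
           (st₂ : GoPowSemiTransitive A B C 2) (st₃ : GoPowSemiTransitive A B C 3) where

    repeated-entry⇒zer : ∀ {p q q′} → q ≢ q′ → A p q ≡ A p q′ → A p q ≡ zer
    repeated-entry⇒zer q≢q′ Apq≡Apq′ =
      layered-block⇒zer ¬LB ¬LC _ (repeated-entry⇒layered st₂ q≢q′ Apq≡Apq′)

    zero-row : ∀ {p j₀} → A p j₀ ≡ zer → ∀ j → A p j ≡ zer
    zero-row {p} {j₀} z j with j ≟ j₀ | ≡zer? (A p j)
    ... | yes refl  | _         = z
    ... | no _      | yes v≡0   = v≡0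
    ... | no j≢j₀   | no v≢0    =
      contradiction (layered-block⇒zer ¬LB ¬LC (A p j) block-layered) v≢0
      where
      block-layered : Layered (X (A p j))
      block-layered = swapped-block-layered st₃ z j≢j₀
        (block-entry-agrees st₂ z j≢j₀ v≢0 (block-entry-nonzero st₃ z j≢j₀ v≢0))

lemma3p9 : {m n : ℕ} (A B C : Matrix m n) → HasZeroEntry A →
    ISTinfinite A B C → ¬ Layered B → ¬ Layered C →
    ∀ p j → A p j ≡ zer
lemma3p9 A B C (p₀ , j₀ , z) ist ¬LB ¬LC p j =
  let (j₁ , j₁≢j₀) = another-column ¬LB j₀
      (j′ , j′≢j)  = another-column ¬LB j
      A-layered : Layered A
      A-layered = subst (Layered ∘ block A B C) z
        (repeated-entry⇒layered {A = A} (ist 2) (≢-sym j₁≢j₀)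
          (trans z (sym (zero-row {A = A} ¬LB ¬LC (ist 2) (ist 3) z j₁))))
  in repeated-entry⇒zer {A = A} ¬LB ¬LC (ist 2) (ist 3) (≢-sym j′≢j) (A-layered p j j′)
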